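{- For every graph $G$ and every integer $d\ge1$, $\chi_{\mathrm{sub}}(G^d)\le \operatorname{subcol}_{2d}(G)$. Moreover, if $d$ is odd, then $\chi_{\mathrm{sub}}(G^d)\le \operatorname{subcol}_{2d-1}(G)$.
   Context: $G^d$ is the $d$-th power of $G$ (same vertex set; distinct $u,v$ adjacent iff $d_G(u,v)\le d$). A $k$-subcolouring is a map $f:V\to\{0,\dots,k-1\}$ whose colour classes each induce a disjoint union of cliques; $\chi_{\mathrm{sub}}$ is the least such $k$. Semi-weak colouring number: for a linear ordering $\sigma$ of $V(G)$, positive integer $k$ and vertex $y$, $x\in\operatorname{SubReach}_k[G,\sigma,y]$ iff there is a path $z_0z_1\dots z_s$ with $z_0=x$, $z_s=y$, $s\le k$, such that $x$ is the $\sigma$-minimum vertex of the path and $y\le_\sigma z_i$ for every $i$ with $\lceil k/2\rceil\le i\le s$. Let $\operatorname{subcol}_k(G,\sigma)=\max_{y}|\operatorname{SubReach}_k[G,\sigma,y]|$ and $\operatorname{subcol}_k(G)=\min_\sigma \operatorname{subcol}_k(G,\sigma)$ over all linear orderings $\sigma$ of $V(G)$. -}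

module Defs where

open import Data.Nat using (ℕ; zero; suc; _≤_; ⌈_/2⌉)
open import Data.Bool using (Bool; true; false)
open import Data.Fin using (Fin; zero; suc; inject₁; fromℕ) renaming (_≤_ to _≤ᶠ_)
open import Data.Fin.Subset using (Subset; _∈_; ∣_∣)
open import Data.Product using (Σ; ∃; _×_)
open import Function.Definitions using (Injective)
open import Function.Bundles using (_⇔_)
open import Relation.Binary.PropositionalEquality using (_≡_; _≢_)

record Graph (n : ℕ) : Set where
  field
    adj    : Fin n → Fin n → Bool
    symm   : ∀ u v → adj u v ≡ adj v u
    irrefl : ∀ u → adj u u ≡ false
open Graph public

E : ∀ {n} → Graph n → Fin n → Fin n → Set
E G u v = adj G u v ≡ true

data Walk {n} (G : Graph n) : Fin n → Fin n → ℕ → Set where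
  here : ∀ {u} → Walk G u u zero
  step : ∀ {u w v ℓ} → E G u w → Walk G w v ℓ → Walk G u v (suc ℓ)

DistLe : ∀ {n} → Graph n → Fin n → Fin n → ℕ → Set
DistLe G u v d = Σ ℕ λ ℓ → ℓ ≤ d × Walk G u v ℓ

PowAdj : ∀ {n} → Graph n → ℕ → Fin n → Fin n → Set
PowAdj G d u v = u ≢ v × DistLe G u v d

-- A k-subcolouring of a graph given by adjacency relation R on Fin n:
-- f : V → {0..k-1} such that each colour class induces a disjoint union
-- of cliques, i.e. the class is partitioned (by `part`) into blocks such that
-- two distinct vertices of the class are adjacent iff they lie in the same block.
record Subcolouring {n} (R : Fin n → Fin n → Set) (k : ℕ) : Set where
  field
    colour : Fin n → Fin k
    part   : Fin n → ℕ
    cliques : ∀ u v → u ≢ v → colour u ≡ colour v → R u v ⇔ (part u ≡ part v)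

χsub≤ : ∀ {n} → (Fin n → Fin n → Set) → ℕ → Set
χsub≤ R k = Subcolouring R k

record LinOrd (n : ℕ) : Set where
  field
    pos : Fin n → Fin n
    pos-inj : Injective _≡_ _≡_ pos
open LinOrd public

_≤[_]_ : ∀ {n} → Fin n → LinOrd n → Fin n → Set
x ≤[ σ ] y = pos σ x ≤ᶠ pos σ y

record Path {n} (G : Graph n) (s : ℕ) : Set where
  field
    z     : Fin (suc s) → Fin n
    z-inj : Injective _≡_ _≡_ z
    z-adj : ∀ (i : Fin s) → E G (z (inject₁ i)) (z (suc i))
open Path public

SubReach : ∀ {n} → ℕ → Graph n → LinOrd n → Fin n → Fin n → Set
SubReach {n} k G σ y x =
  Σ ℕ λ s → s ≤ k × Σ (Path G s) λ P →
    (z P zero ≡ x) × (z P (fromℕ s) ≡ y)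
    × (∀ i → x ≤[ σ ] z P i)
    × (∀ (i : Fin (suc s)) → ⌈ k /2⌉ ≤ Data.Fin.toℕ i → y ≤[ σ ] z P i)

-- subcol_k(G,σ) ≤ m : every y has |SubReach_k[G,σ,y]| ≤ m
-- (every subset of SubReach_k[G,σ,y] has at most m elements)
subcolσ≤ : ∀ {n} → ℕ → Graph n → LinOrd n → ℕ → Set
subcolσ≤ {n} k G σ m = ∀ (y : Fin n) (S : Subset n) → (∀ x → x ∈ S → SubReach k G σ y x) → ∣ S ∣ ≤ m

subcol≤ : ∀ {n} → ℕ → Graph n → ℕ → Set
subcol≤ k G m = ∃ λ σ → subcolσ≤ k G σ m

-- Let r = ⌊d/2⌋ and send every vertex u to the σ-least vertex α u of its r-ball. Vertices with
-- the same representative are at distance at most 2r ≤ d, so the fibres of α are cliques of G^d.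
-- Call representatives a <σ a' conflicting if some u ↦ a and v ↦ a' are adjacent in G^d. The walk
-- a ⇝ u ⇝ v ⇝ a' has length at most r + d + r ≤ k, never goes σ-below a, and from position
-- d ≤ ⌈k/2⌉ on it stays in the r-ball of v, hence σ-above a'; shortening it to a path keeps these
-- properties, so a ∈ SubReach_k[G,σ,a']. Hence every representative has fewer than subcol_k(G,σ)
-- conflicting σ-predecessors, and colouring representatives greedily along σ and u by the colour
-- of α u gives a subcolouring of G^d. The argument only uses 2r + d ≤ k and d ≤ ⌈k/2⌉, which
-- k = 2d always satisfies and k = 2d − 1 satisfies when d is odd.
module Submission where

open import Defs
open import Data.Nat using (ℕ; _≤_; _*_; _∸_; _%_)
open import Data.Product using (_×_)
open import Relation.Binary.PropositionalEquality using (_≡_)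

open import Data.Nat using (zero; suc; _+_; _<_; z≤n; s≤s; ⌈_/2⌉; ⌊_/2⌋; _/_; anyUpTo?)
open import Data.Nat.Properties
open import Data.Nat.DivMod using (m≡m%n+[m/n]*n)
open import Data.Bool using (true) renaming (_≟_ to _≟ᵇ_)
open import Data.Fin using (Fin; zero; suc; toℕ; fromℕ; fromℕ<; inject₁)
open import Data.Fin.Properties using (any?; ¬∀⟶∃¬; toℕ-injective) renaming (_≟_ to _≟ᶠ_)
import Data.Fin.Properties as Fin
open import Data.Fin.Subset using (Subset; _∈_; ∣_∣; _-_)
open import Data.Fin.Subset.Properties using (x∈p⇒∣p-x∣<∣p∣; x∈p∧x≢y⇒x∈p-y)
open import Data.Vec using (Vec; []; _∷_; lookup; tabulate)
open import Data.Vec.Properties using ([]=⇒lookup; lookup⇒[]=; lookup∘tabulate)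
open import Data.Vec.Relation.Unary.All using (All; []; _∷_)
open import Data.Vec.Relation.Unary.Any using (here; there)
open import Data.Vec.Relation.Unary.Unique.Propositional using (Unique; []; _∷_)
open import Data.Vec.Relation.Unary.Unique.Propositional.Properties using (lookup-injective)
open import Data.Vec.Membership.Propositional using () renaming (_∈_ to _∈ᵥ_; _∉_ to _∉ᵥ_)
import Data.Vec.Membership.DecPropositional as DecMembership
open import Data.Product using (Σ; ∃-syntax; _,_; proj₁; proj₂; map₂)
open import Data.Sum using (_⊎_; inj₁; inj₂; [_,_]′)
open import Data.Empty using (⊥)
open import Function using (_∘_)
open import Function.Bundles using (mk⇔)
open import Function.Definitions using (Injective)
open import Relation.Nullary using (Dec; yes; no; ¬_; does; contradiction)
open import Relation.Nullary.Decidable using (_×-dec_; _⊎-dec_; dec-true; map′)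
open import Level using (0ℓ)
open import Relation.Unary using (Pred; Decidable)
open import Relation.Binary.PropositionalEquality
  using (refl; sym; trans; cong; subst; _≢_; module ≡-Reasoning)
open import Relation.Binary.Definitions using (Tri; tri<; tri≈; tri>)

data AllFrom {A : Set} (Q : ℕ → A → Set) : ℕ → ∀ {ℓ} → Vec A ℓ → Set where
  []  : ∀ {o} → AllFrom Q o []
  _∷_ : ∀ {o x ℓ} {xs : Vec A ℓ} → Q o x → AllFrom Q (suc o) xs → AllFrom Q o (x ∷ xs)

DownwardClosed : {A : Set} → (ℕ → A → Set) → Set
DownwardClosed Q = ∀ {i j x} → j ≤ i → Q i x → Q j x

module _ {A : Set} {Q : ℕ → A → Set} where

  allFrom-weaken : DownwardClosed Q → ∀ {i j ℓ} {xs : Vec A ℓ} →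
                   j ≤ i → AllFrom Q i xs → AllFrom Q j xs
  allFrom-weaken closed j≤i []         = []
  allFrom-weaken closed j≤i (qx ∷ qxs) = closed j≤i qx ∷ allFrom-weaken closed (s≤s j≤i) qxs

  allFrom-lookup : ∀ {o ℓ} {xs : Vec A ℓ} → AllFrom Q o xs → ∀ i → Q (o + toℕ i) (lookup xs i)
  allFrom-lookup {o} {xs = x ∷ _}  (qx ∷ _)   zero    = subst (λ j → Q j x) (sym (+-identityʳ o)) qx
  allFrom-lookup {o} {xs = _ ∷ xs} (_  ∷ qxs) (suc i) =
    subst (λ j → Q j (lookup xs i)) (sym (+-suc o (toℕ i))) (allFrom-lookup qxs i)

injective⇒≤∣p∣ : ∀ {m n} {f : Fin m → Fin n} (p : Subset n) →
                 Injective _≡_ _≡_ f → (∀ i → f i ∈ p) → m ≤ ∣ p ∣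
injective⇒≤∣p∣ {zero}          p f-inj f∈p = z≤n
injective⇒≤∣p∣ {suc m} {f = f} p f-inj f∈p =
  <-≤-trans (s≤s (injective⇒≤∣p∣ (p - f zero) (Fin.suc-injective ∘ f-inj) f[suc]∈p-f[0]))
            (x∈p⇒∣p-x∣<∣p∣ (f∈p zero))
  where
  f[suc]∈p-f[0] : ∀ i → f (suc i) ∈ p - f zero
  f[suc]∈p-f[0] i = x∈p∧x≢y⇒x∈p-y (f∈p (suc i)) (λ eq → Fin.0≢1+n (sym (f-inj eq)))

module _ {n} {P : Pred (Fin n) 0ℓ} (P? : Decidable P) where

  subsetOf : Subset n
  subsetOf = tabulate (does ∘ P?)

  ∈-subsetOf⁺ : ∀ {x} → P x → x ∈ subsetOf
  ∈-subsetOf⁺ {x} px =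
    lookup⇒[]= x subsetOf (trans (lookup∘tabulate (does ∘ P?) x) (dec-true (P? x) px))

  ∈-subsetOf⁻ : ∀ {x} → x ∈ subsetOf → P x
  ∈-subsetOf⁻ {x} x∈ with P? x | trans (sym (lookup∘tabulate (does ∘ P?) x)) ([]=⇒lookup x∈)
  ... | yes px | _ = px
  ... | no _   | ()

argmin : ∀ {n} {P : Pred (Fin n) 0ℓ} (f : Fin n → ℕ) → Decidable P →
         ∀ {x} → P x → ∃[ a ] P a × (∀ {y} → P y → f a ≤ f y)
argmin {P = P} f P? {x} px = search (suc (f x)) ≤-refl px
  where
  search : ∀ bound {x} → f x < bound → P x → ∃[ a ] P a × (∀ {y} → P y → f a ≤ f y)
  search (suc bound) {x} (s≤s fx≤bound) px with any? (λ y → P? y ×-dec (f y <? f x))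
  ... | yes (y , py , fy<fx) = search bound (<-≤-trans fy<fx fx≤bound) py
  ... | no none              = x , px , λ py → ≮⇒≥ (λ fy<fx → none (_ , py , fy<fx))

module GreedyColouring {n m : ℕ} (rank : Fin n → ℕ) {D : Fin n → Fin n → Set}
                       (D? : ∀ a v → Dec (D a v)) (D⇒< : ∀ {a v} → D a v → rank a < rank v)
                       (fewPredecessors : ∀ v (h : Fin m → Fin n) → Injective _≡_ _≡_ h →
                                          (∀ i → D (h i) v) → ⊥) where

  freeColour : ∀ v (c : Fin n → Fin m) → ∃[ j ] (∀ {a} → D a v → c a ≢ j)
  freeColour v c = map₂ (λ unused dav caj → unused (_ , dav , caj)) (¬∀⟶∃¬ m Used used? allUsed⇒⊥)
    where
    Used : Fin m → Set
    Used j = ∃[ a ] D a v × c a ≡ j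

    used? : Decidable Used
    used? j = any? λ a → D? a v ×-dec (c a ≟ᶠ j)

    allUsed⇒⊥ : ¬ (∀ j → Used j)
    allUsed⇒⊥ used = fewPredecessors v (proj₁ ∘ used) witness-injective (proj₁ ∘ proj₂ ∘ used)
      where
      witness-injective : Injective _≡_ _≡_ (proj₁ ∘ used)
      witness-injective {i} {j} eq =
        trans (sym (proj₂ (proj₂ (used i)))) (trans (cong c eq) (proj₂ (proj₂ (used j))))

  -- m ≠ 0, since otherwise the empty map would be an injection into the predecessors of v
  someColour : Fin n → Fin m
  someColour v = fromℕ< (n≢0⇒n>0 λ { refl → fewPredecessors v (λ ()) (λ { {()} }) (λ ()) })

  recolour : ℕ → (Fin n → Fin m) → Fin n → Fin m
  recolour t c v with rank v ≟ t
  ... | yes _ = proj₁ (freeColour v c)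
  ... | no _  = c v

  -- vertices of rank below t are already properly coloured by `colourUpTo t`
  colourUpTo : ℕ → Fin n → Fin m
  colourUpTo zero    = someColour
  colourUpTo (suc t) = recolour t (colourUpTo t)

  colour : Fin n → Fin m
  colour v = colourUpTo (suc (rank v)) v

  colour-fresh : ∀ v → colour v ≡ proj₁ (freeColour v (colourUpTo (rank v)))
  colour-fresh v with rank v ≟ rank v
  ... | yes _    = refl
  ... | no rv≢rv = contradiction refl rv≢rv

  colourUpTo-stable : ∀ {t} v → rank v < t → colourUpTo t v ≡ colour v
  colourUpTo-stable {suc t} v (s≤s rv≤t) with rank v ≟ t
  ... | yes refl = sym (colour-fresh v)
  ... | no rv≢t  = colourUpTo-stable v (≤∧≢⇒< rv≤t rv≢t)

  colour-proper : ∀ {a v} → D a v → colour a ≢ colour v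
  colour-proper {a} {v} dav ca≡cv = proj₂ (freeColour v (colourUpTo (rank v))) dav (begin
    colourUpTo (rank v) a                         ≡⟨ colourUpTo-stable a (D⇒< dav) ⟩
    colour a                                      ≡⟨ ca≡cv ⟩
    colour v                                      ≡⟨ colour-fresh v ⟩
    proj₁ (freeColour v (colourUpTo (rank v)))    ∎)
    where open ≡-Reasoning

module Walks {n} (G : Graph n) where

  open DecMembership (_≟ᶠ_ {n}) using (_∈?_)

  E-sym : ∀ {u v} → E G u v → E G v u
  E-sym {u} {v} e = trans (symm G v u) e

  _▷_ : ∀ {u v w ℓ} → Walk G u v ℓ → E G v w → Walk G u w (suc ℓ)
  here       ▷ e = step e here
  step e′ p  ▷ e = step e′ (p ▷ e)

  reverse : ∀ {u v ℓ} → Walk G u v ℓ → Walk G v u ℓ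
  reverse here       = here
  reverse (step e p) = reverse p ▷ E-sym e

  _++ʷ_ : ∀ {u v w a b} → Walk G u v a → Walk G v w b → Walk G u w (a + b)
  here     ++ʷ q = q
  step e p ++ʷ q = step e (p ++ʷ q)

  walk? : ∀ ℓ u v → Dec (Walk G u v ℓ)
  walk? zero u v with u ≟ᶠ v
  ... | yes refl = yes here
  ... | no u≢v   = no λ { here → u≢v refl }
  walk? (suc ℓ) u v =
    map′ (λ (w , e , p) → step e p) (λ { (step e p) → _ , e , p })
         (any? λ w → (adj G u w ≟ᵇ true) ×-dec walk? ℓ w v)

  distLe? : ∀ r u v → Dec (DistLe G u v r)
  distLe? r u v = map′ (λ (ℓ , ℓ<1+r , p) → ℓ , ≤-pred ℓ<1+r , p)
                       (λ (ℓ , ℓ≤r , p) → ℓ , s≤s ℓ≤r , p)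
                       (anyUpTo? (λ ℓ → walk? ℓ u v) (suc r))

  distLe-mono : ∀ {u v r s} → r ≤ s → DistLe G u v r → DistLe G u v s
  distLe-mono r≤s (ℓ , ℓ≤r , p) = ℓ , ≤-trans ℓ≤r r≤s , p

  distLe-sym : ∀ {u v r} → DistLe G u v r → DistLe G v u r
  distLe-sym (ℓ , ℓ≤r , p) = ℓ , ℓ≤r , reverse p

  distLe-trans : ∀ {u v w r s} → DistLe G u v r → DistLe G v w s → DistLe G u w (r + s)
  distLe-trans (ℓ , ℓ≤r , p) (ℓ′ , ℓ′≤s , q) = ℓ + ℓ′ , +-mono-≤ ℓ≤r ℓ′≤s , p ++ʷ q

  successors : ∀ {u v ℓ} → Walk G u v ℓ → Vec (Fin n) ℓ
  successors here                = []
  successors (step {w = w} _ p)  = w ∷ successors p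

  vertices : ∀ {u v ℓ} → Walk G u v ℓ → Vec (Fin n) (suc ℓ)
  vertices {u} p = u ∷ successors p

  allFrom-splits : ∀ {Q o u v ℓ} (p : Walk G u v ℓ) →
                   (∀ {j x ℓ′} → Walk G u x j → Walk G x v ℓ′ → j + ℓ′ ≡ ℓ → Q (o + j) x) →
                   AllFrom Q o (vertices p)
  allFrom-splits {Q} {o} {u} here splitting =
    subst (λ i → Q i u) (+-identityʳ o) (splitting here here refl) ∷ []
  allFrom-splits {Q} {o} {u} (step e p) splitting =
    subst (λ i → Q i u) (+-identityʳ o) (splitting here (step e p) refl)
    ∷ allFrom-splits p λ {j} {x} u⇝x x⇝v eq →
        subst (λ i → Q i x) (+-suc o j) (splitting (step e u⇝x) x⇝v (cong suc eq))

  allFrom-++ʷ : ∀ {Q o u v w a b} (p : Walk G u v a) (q : Walk G v w b) →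
                AllFrom Q o (vertices p) → AllFrom Q (o + a) (vertices q) →
                AllFrom Q o (vertices (p ++ʷ q))
  allFrom-++ʷ {Q} {o} here q _ qs = subst (λ i → AllFrom Q i (vertices q)) (+-identityʳ o) qs
  allFrom-++ʷ {Q} {o} (step {ℓ = a} e p) q (qu ∷ ps) qs =
    qu ∷ allFrom-++ʷ p q ps (subst (λ i → AllFrom Q i (vertices q)) (+-suc o a) qs)

  record ShortWalk (Q : ℕ → Fin n → Set) (o : ℕ) (x y : Fin n) (ℓ : ℕ) : Set where
    field
      length  : ℕ
      length≤ : length ≤ ℓ
      walk    : Walk G x y length
      unique  : Unique (vertices walk)
      allFrom : AllFrom Q o (vertices walk)
  open ShortWalk

  shortWalk-weaken : ∀ {Q o o′ x y ℓ ℓ′} → DownwardClosed Q → o′ ≤ o → ℓ ≤ ℓ′ →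
                     ShortWalk Q o x y ℓ → ShortWalk Q o′ x y ℓ′
  shortWalk-weaken closed o′≤o ℓ≤ℓ′ s = record
    { length = length s ; length≤ = ≤-trans (length≤ s) ℓ≤ℓ′ ; walk = walk s ; unique = unique s
    ; allFrom = allFrom-weaken closed o′≤o (allFrom s) }

  suffixFrom : ∀ {Q o x y z ℓ} → DownwardClosed Q → (p : Walk G y z ℓ) → x ∈ᵥ vertices p →
               Unique (vertices p) → AllFrom Q o (vertices p) → ShortWalk Q o x z ℓ
  suffixFrom closed p (here refl) uniq qs =
    record { length = _ ; length≤ = ≤-refl ; walk = p ; unique = uniq ; allFrom = qs }
  suffixFrom closed (step e p) (there x∈) (_ ∷ uniq) (_ ∷ qs) =
    shortWalk-weaken closed (n≤1+n _) (n≤1+n _) (suffixFrom closed p x∈ uniq qs)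

  ∉⇒All≢ : ∀ {x ℓ} {xs : Vec (Fin n) ℓ} → x ∉ᵥ xs → All (x ≢_) xs
  ∉⇒All≢ {xs = []}     _  = []
  ∉⇒All≢ {xs = _ ∷ _}  x∉ = (x∉ ∘ here) ∷ ∉⇒All≢ (x∉ ∘ there)

  -- cut every cycle at the first repeated vertex; positions only decrease, hence DownwardClosed
  shortcut : ∀ {Q o x y ℓ} → DownwardClosed Q → (p : Walk G x y ℓ) → AllFrom Q o (vertices p) →
             ShortWalk Q o x y ℓ
  shortcut closed here qs =
    record { length = 0 ; length≤ = z≤n ; walk = here ; unique = [] ∷ [] ; allFrom = qs }
  shortcut {x = x} closed (step e p) (qx ∷ qs) with shortcut closed p qs
  ... | s with x ∈? vertices (walk s)
  ...   | yes x∈ = shortWalk-weaken closed (n≤1+n _) (m≤n⇒m≤1+n (length≤ s))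
                     (suffixFrom closed (walk s) x∈ (unique s) (allFrom s))
  ...   | no x∉  = record { length = suc (length s) ; length≤ = s≤s (length≤ s)
                          ; walk = step e (walk s) ; unique = ∉⇒All≢ x∉ ∷ unique s
                          ; allFrom = qx ∷ allFrom s }

  lookup-vertices-adjacent : ∀ {x y ℓ} (p : Walk G x y ℓ) (i : Fin ℓ) →
                             E G (lookup (vertices p) (inject₁ i)) (lookup (vertices p) (suc i))
  lookup-vertices-adjacent (step e p) zero    = e
  lookup-vertices-adjacent (step e p) (suc i) = lookup-vertices-adjacent p i

  lookup-vertices-last : ∀ {x y ℓ} (p : Walk G x y ℓ) → lookup (vertices p) (fromℕ ℓ) ≡ y
  lookup-vertices-last here       = refl
  lookup-vertices-last (step e p) = lookup-vertices-last p

  walk⇒path : ∀ {Q x y ℓ} → DownwardClosed Q → (p : Walk G x y ℓ) → AllFrom Q 0 (vertices p) →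
              ∃[ s ] s ≤ ℓ × Σ (Path G s) λ P →
                z P zero ≡ x × z P (fromℕ s) ≡ y × (∀ i → Q (toℕ i) (z P i))
  walk⇒path closed p qs =
    length s , length≤ s
    , record { z = lookup (vertices (walk s)) ; z-inj = lookup-injective (unique s) _ _
             ; z-adj = lookup-vertices-adjacent (walk s) }
    , refl , lookup-vertices-last (walk s) , allFrom-lookup (allFrom s)
    where
    s = shortcut closed p qs

j+ℓ≤1+2r∧r<ℓ⇒j≤r : ∀ {j ℓ r} → j + ℓ ≤ suc (r + r) → r < ℓ → j ≤ r
j+ℓ≤1+2r∧r<ℓ⇒j≤r {j} {ℓ} {r} j+ℓ≤1+2r r<ℓ = +-cancelʳ-≤ (suc r) j r (begin
  j + suc r    ≤⟨ +-monoʳ-≤ j r<ℓ ⟩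
  j + ℓ        ≤⟨ j+ℓ≤1+2r ⟩
  suc (r + r)  ≡⟨ +-suc r r ⟨
  r + suc r    ∎)
  where open ≤-Reasoning

p≤r∧j+ℓ≤d∧r<ℓ⇒p+j<d : ∀ {p j ℓ r d} → p ≤ r → j + ℓ ≤ d → r < ℓ → p + j < d
p≤r∧j+ℓ≤d∧r<ℓ⇒p+j<d {p} {j} {ℓ} {r} {d} p≤r j+ℓ≤d r<ℓ = begin-strict
  p + j  ≤⟨ +-monoˡ-≤ j p≤r ⟩
  r + j  <⟨ +-monoˡ-< j r<ℓ ⟩
  ℓ + j  ≡⟨ +-comm ℓ j ⟩
  j + ℓ  ≤⟨ j+ℓ≤d ⟩
  d      ∎
  where open ≤-Reasoning

module PowerColouring {n} (G : Graph n) (σ : LinOrd n) {d r k m : ℕ}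
                      (r<d : r < d) (r+r≤d : r + r ≤ d) (d≤1+r+r : d ≤ suc (r + r))
                      (r+r+d≤k : r + r + d ≤ k) (d≤⌈k/2⌉ : d ≤ ⌈ k /2⌉)
                      (subcol : subcolσ≤ k G σ m) where

  open Walks G

  rank : Fin n → ℕ
  rank x = toℕ (pos σ x)

  rank-injective : ∀ {x y} → rank x ≡ rank y → x ≡ y
  rank-injective = pos-inj σ ∘ toℕ-injective

  ballMinimum : ∀ u → ∃[ a ] DistLe G u a r × (∀ {x} → DistLe G u x r → a ≤[ σ ] x)
  ballMinimum u = argmin rank (distLe? r u) (0 , z≤n , here)

  representative : Fin n → Fin n
  representative u = proj₁ (ballMinimum u)

  representative-near : ∀ u → DistLe G u (representative u) r
  representative-near u = proj₁ (proj₂ (ballMinimum u))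

  representative-minimal : ∀ u {x} → DistLe G u x r → representative u ≤[ σ ] x
  representative-minimal u = proj₂ (proj₂ (ballMinimum u))

  Conflict : Fin n → Fin n → Set
  Conflict a a′ = rank a < rank a′ × ∃[ u ] ∃[ v ]
    representative u ≡ a × representative v ≡ a′ × DistLe G u v d

  conflict? : ∀ a a′ → Dec (Conflict a a′)
  conflict? a a′ = (rank a <? rank a′) ×-dec any? λ u → any? λ v →
    (representative u ≟ᶠ a) ×-dec ((representative v ≟ᶠ a′) ×-dec distLe? d u v)

  conflict⇒≢ : ∀ {a a′} → Conflict a a′ → a ≢ a′
  conflict⇒≢ (a<a′ , _) refl = <-irrefl refl a<a′

  Guarded : Fin n → Fin n → ℕ → Fin n → Set
  Guarded x y i w = x ≤[ σ ] w × (d ≤ i → y ≤[ σ ] w)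

  guarded-closed : ∀ {x y} → DownwardClosed (Guarded x y)
  guarded-closed j≤i (x≤w , y≤w) = x≤w , λ d≤j → y≤w (≤-trans d≤j j≤i)

  walk⇒subReach : ∀ {x y ℓ} (p : Walk G x y ℓ) → ℓ ≤ k → AllFrom (Guarded x y) 0 (vertices p) →
                  SubReach k G σ y x
  walk⇒subReach p ℓ≤k guarded with walk⇒path guarded-closed p guarded
  ... | s , s≤ℓ , P , start , end , onPath =
    s , ≤-trans s≤ℓ ℓ≤k , P , start , end , proj₁ ∘ onPath
    , λ i ⌈k/2⌉≤i → proj₂ (onPath i) (≤-trans d≤⌈k/2⌉ ⌈k/2⌉≤i)

  self∈subReach : ∀ y → SubReach k G σ y y
  self∈subReach y = walk⇒subReach here z≤n ((≤-refl , λ _ → ≤-refl) ∷ [])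

  conflict⇒subReach : ∀ {a a′} → Conflict a a′ → SubReach k G σ a′ a
  conflict⇒subReach (a<a′ , u , v , refl , refl , q , q≤d , u⇝v)
    with representative-near u | representative-near v
  ... | p , p≤r , u⇝a | t , t≤r , v⇝a′ =
    walk⇒subReach (reverse u⇝a ++ʷ (u⇝v ++ʷ v⇝a′)) length≤k
      (allFrom-++ʷ (reverse u⇝a) _ first (allFrom-++ʷ u⇝v v⇝a′ middle last))
    where
    a  = representative u
    a′ = representative v

    length≤k : p + (q + t) ≤ k
    length≤k = begin
      p + (q + t)  ≤⟨ +-mono-≤ p≤r (+-mono-≤ q≤d t≤r) ⟩
      r + (d + r)  ≡⟨ cong (r +_) (+-comm d r) ⟩
      r + (r + d)  ≡⟨ +-assoc r r d ⟨
      r + r + d    ≤⟨ r+r+d≤k ⟩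
      k            ∎
      where open ≤-Reasoning

    near-u : ∀ {i x} → i < d → DistLe G u x r → Guarded a a′ i x
    near-u i<d ux = representative-minimal u ux , λ d≤i → contradiction d≤i (<⇒≱ i<d)

    near-v : ∀ {i x} → DistLe G v x r → Guarded a a′ i x
    near-v vx = ≤-trans (<⇒≤ a<a′) (representative-minimal v vx) , λ _ → representative-minimal v vx

    first : AllFrom (Guarded a a′) 0 (vertices (reverse u⇝a))
    first = allFrom-splits (reverse u⇝a) λ {j} {_} {ℓ′} _ x⇝u j+ℓ′≡p →
      let j+ℓ′≤r = ≤-trans (≤-reflexive j+ℓ′≡p) p≤r in
      near-u (≤-<-trans (m+n≤o⇒m≤o j j+ℓ′≤r) r<d) (ℓ′ , m+n≤o⇒n≤o j j+ℓ′≤r , reverse x⇝u)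

    middle : AllFrom (Guarded a a′) p (vertices u⇝v)
    middle = allFrom-splits u⇝v vertex
      where
      vertex : ∀ {j x ℓ′} → Walk G u x j → Walk G x v ℓ′ → j + ℓ′ ≡ q → Guarded a a′ (p + j) x
      vertex {j} {_} {ℓ′} u⇝x x⇝v j+ℓ′≡q with ℓ′ ≤? r
      ... | yes ℓ′≤r = near-v (ℓ′ , ℓ′≤r , reverse x⇝v)
      ... | no ℓ′≰r  =
        let j+ℓ′≤d = ≤-trans (≤-reflexive j+ℓ′≡q) q≤d
            r<ℓ′   = ≰⇒> ℓ′≰r in
        near-u (p≤r∧j+ℓ≤d∧r<ℓ⇒p+j<d p≤r j+ℓ′≤d r<ℓ′)
               (j , j+ℓ≤1+2r∧r<ℓ⇒j≤r (≤-trans j+ℓ′≤d d≤1+r+r) r<ℓ′ , u⇝x)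

    last : AllFrom (Guarded a a′) (p + q) (vertices v⇝a′)
    last = allFrom-splits v⇝a′ λ {j} v⇝x _ j+ℓ′≡t →
      near-v (j , m+n≤o⇒m≤o j (≤-trans (≤-reflexive j+ℓ′≡t) t≤r) , v⇝x)

  fewConflicts : ∀ v (h : Fin m → Fin n) → Injective _≡_ _≡_ h → (∀ i → Conflict (h i) v) → ⊥
  fewConflicts v h h-inj h-conflict =
    1+n≰n (≤-trans (injective⇒≤∣p∣ reach H-inj (∈-subsetOf⁺ reaches? ∘ H-reaches))
                   (subcol v reach reach⊆))
    where
    reaches? : Decidable (λ x → x ≡ v ⊎ Conflict x v)
    reaches? x = (x ≟ᶠ v) ⊎-dec conflict? x v

    reach : Subset n
    reach = subsetOf reaches?

    reach⊆ : ∀ x → x ∈ reach → SubReach k G σ v x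
    reach⊆ x x∈ = [ (λ { refl → self∈subReach v }) , conflict⇒subReach ]′ (∈-subsetOf⁻ reaches? x∈)

    H : Fin (suc m) → Fin n
    H zero    = v
    H (suc i) = h i

    H-reaches : ∀ i → H i ≡ v ⊎ Conflict (H i) v
    H-reaches zero    = inj₁ refl
    H-reaches (suc i) = inj₂ (h-conflict i)

    H-inj : Injective _≡_ _≡_ H
    H-inj {zero}  {zero}  _  = refl
    H-inj {zero}  {suc j} eq = contradiction (sym eq) (conflict⇒≢ (h-conflict j))
    H-inj {suc i} {zero}  eq = contradiction eq (conflict⇒≢ (h-conflict i))
    H-inj {suc i} {suc j} eq = cong suc (h-inj eq)

  open GreedyColouring rank conflict? proj₁ fewConflicts using (colour; colour-proper)

  power-adjacent⇒same-rank : ∀ u v → colour (representative u) ≡ colour (representative v) →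
                             PowAdj G d u v → rank (representative u) ≡ rank (representative v)
  power-adjacent⇒same-rank u v same (_ , uv) = byRank (<-cmp ρu ρv)
    where
    ρu = rank (representative u)
    ρv = rank (representative v)

    byRank : Tri (ρu < ρv) (ρu ≡ ρv) (ρv < ρu) → ρu ≡ ρv
    byRank (tri< ρu<ρv _ _) = contradiction same (colour-proper (ρu<ρv , u , v , refl , refl , uv))
    byRank (tri≈ _ ρu≡ρv _) = ρu≡ρv
    byRank (tri> _ _ ρv<ρu) =
      contradiction (sym same) (colour-proper (ρv<ρu , v , u , refl , refl , distLe-sym uv))

  same-rank⇒power-adjacent : ∀ {u v} → u ≢ v → rank (representative u) ≡ rank (representative v) →
                             PowAdj G d u v
  same-rank⇒power-adjacent {u} {v} u≢v eq = u≢v , distLe-mono r+r≤d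
    (distLe-trans (subst (λ a → DistLe G u a r) (rank-injective eq) (representative-near u))
                  (distLe-sym (representative-near v)))

  subcolouring : χsub≤ (PowAdj G d) m
  subcolouring = record
    { colour  = colour ∘ representative
    ; part    = rank ∘ representative
    ; cliques = λ u v u≢v same →
        mk⇔ (power-adjacent⇒same-rank u v same) (same-rank⇒power-adjacent u≢v)
    }

χsub-power≤subcol : ∀ {n} (G : Graph n) {d r k m} → r < d → r + r ≤ d → d ≤ suc (r + r) →
                    r + r + d ≤ k → d ≤ ⌈ k /2⌉ → subcol≤ k G m → χsub≤ (PowAdj G d) m
χsub-power≤subcol G r<d r+r≤d d≤1+r+r r+r+d≤k d≤⌈k/2⌉ (σ , subcol) =
  PowerColouring.subcolouring G σ r<d r+r≤d d≤1+r+r r+r+d≤k d≤⌈k/2⌉ subcol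

⌊n/2⌋+⌊n/2⌋≤n : ∀ n → ⌊ n /2⌋ + ⌊ n /2⌋ ≤ n
⌊n/2⌋+⌊n/2⌋≤n n = subst (⌊ n /2⌋ + ⌊ n /2⌋ ≤_) (⌊n/2⌋+⌈n/2⌉≡n n) (+-monoʳ-≤ ⌊ n /2⌋ (⌊n/2⌋≤⌈n/2⌉ n))

n≤1+⌊n/2⌋+⌊n/2⌋ : ∀ n → n ≤ suc (⌊ n /2⌋ + ⌊ n /2⌋)
n≤1+⌊n/2⌋+⌊n/2⌋ n = begin
  n                          ≡⟨ ⌊n/2⌋+⌈n/2⌉≡n n ⟨
  ⌊ n /2⌋ + ⌈ n /2⌉          ≤⟨ +-monoʳ-≤ ⌊ n /2⌋ (⌊n/2⌋-mono (n≤1+n (suc n))) ⟩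
  ⌊ n /2⌋ + suc ⌊ n /2⌋      ≡⟨ +-suc ⌊ n /2⌋ ⌊ n /2⌋ ⟩
  suc (⌊ n /2⌋ + ⌊ n /2⌋)    ∎
  where open ≤-Reasoning

⌈2n/2⌉≡n : ∀ n → ⌈ 2 * n /2⌉ ≡ n
⌈2n/2⌉≡n n = sym (trans (n≡⌈n+n/2⌉ n) (cong (λ m → ⌈ n + m /2⌉) (sym (+-identityʳ n))))

⌈[2n∸1]/2⌉≡n : ∀ n → ⌈ 2 * n ∸ 1 /2⌉ ≡ n
⌈[2n∸1]/2⌉≡n zero    = refl
⌈[2n∸1]/2⌉≡n (suc n) = begin
  ⌈ n + suc (n + 0) /2⌉   ≡⟨ cong (λ m → ⌈ n + suc m /2⌉) (+-identityʳ n) ⟩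
  ⌈ n + suc n /2⌉         ≡⟨ cong ⌈_/2⌉ (+-suc n n) ⟩
  suc ⌊ n + n /2⌋         ≡⟨ cong suc (n≡⌊n+n/2⌋ n) ⟨
  suc n                   ∎
  where open ≡-Reasoning

n%2≡1⇒n≡1+[n/2]+[n/2] : ∀ n → n % 2 ≡ 1 → n ≡ suc (n / 2 + n / 2)
n%2≡1⇒n≡1+[n/2]+[n/2] n odd = begin
  n                        ≡⟨ m≡m%n+[m/n]*n n 2 ⟩
  n % 2 + n / 2 * 2        ≡⟨ cong (_+ n / 2 * 2) odd ⟩
  suc (n / 2 * 2)          ≡⟨ cong suc (*-comm (n / 2) 2) ⟩
  suc (n / 2 + (n / 2 + 0)) ≡⟨ cong (λ m → suc (n / 2 + m)) (+-identityʳ (n / 2)) ⟩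
  suc (n / 2 + n / 2)      ∎
  where open ≡-Reasoning

χsub-power≤subcol-2d : ∀ {n} (G : Graph n) d {m} →
                       subcol≤ (2 * suc d) G m → χsub≤ (PowAdj G (suc d)) m
χsub-power≤subcol-2d G d = χsub-power≤subcol G (⌊n/2⌋<n d) r+r≤1+d (n≤1+⌊n/2⌋+⌊n/2⌋ (suc d))
  (≤-trans (+-monoˡ-≤ (suc d) r+r≤1+d) (≤-reflexive (cong (suc d +_) (sym (+-identityʳ (suc d))))))
  (≤-reflexive (sym (⌈2n/2⌉≡n (suc d))))
  where
  r+r≤1+d = ⌊n/2⌋+⌊n/2⌋≤n (suc d)

χsub-oddPower≤subcol-2d-1 : ∀ {n} (G : Graph n) r {m} →
                            subcol≤ (2 * suc (r + r) ∸ 1) G m → χsub≤ (PowAdj G (suc (r + r))) m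
χsub-oddPower≤subcol-2d-1 G r = χsub-power≤subcol G (s≤s (m≤m+n r r)) (n≤1+n (r + r)) ≤-refl
  (≤-reflexive (cong (λ m → r + r + suc m) (sym (+-identityʳ (r + r)))))
  (≤-reflexive (sym (⌈[2n∸1]/2⌉≡n (suc (r + r)))))

mainTheorem6 : ∀ (n : ℕ) (G : Graph n) (d : ℕ) → 1 ≤ d →
    (∀ m → subcol≤ (2 * d) G m → χsub≤ (PowAdj G d) m)
    × (d % 2 ≡ 1 → ∀ m → subcol≤ (2 * d ∸ 1) G m → χsub≤ (PowAdj G d) m)
mainTheorem6 n G (suc d) _ = (λ m → χsub-power≤subcol-2d G d) , oddBound
  where
  oddBound : suc d % 2 ≡ 1 → ∀ m → subcol≤ (2 * suc d ∸ 1) G m → χsub≤ (PowAdj G (suc d)) m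
  oddBound odd m = subst (λ e → subcol≤ (2 * e ∸ 1) G m → χsub≤ (PowAdj G e) m)
    (sym (n%2≡1⇒n≡1+[n/2]+[n/2] (suc d) odd)) (χsub-oddPower≤subcol-2d-1 G (suc d / 2))
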